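{- Let $\mathcal{F}$ be a strong greedoid on a finite ground set $E$. Let $B_1,B_2\in\mathcal{F}$ satisfy $|B_1|=|B_2|$, and let $x\in B_1\setminus B_2$. Then there exists $y\in B_2\setminus B_1$ such that $(B_1\cup\{y\})\setminus\{x\}\in\mathcal{F}$.
   Context: A collection $\mathcal{F}$ of subsets of a finite set $E$ is a greedoid if: (i) $\varnothing\in\mathcal{F}$; (ii) if $B\in\mathcal{F}$ and $|B|>0$, there is $b\in B$ with $B\setminus\{b\}\in\mathcal{F}$; (iii) if $A,B\in\mathcal{F}$ with $|B|=|A|+1$, there is $b\in B\setminus A$ with $A\cup\{b\}\in\mathcal{F}$. A greedoid is a strong greedoid if moreover: (iv) whenever $A,B\in\mathcal{F}$ with $|B|=|A|+1$, there is $x\in B\setminus A$ such that $A\cup\{x\}\in\mathcal{F}$ and $B\setminus\{x\}\in\mathcal{F}$. -}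

module Defs where

open import Data.Nat using (ℕ; suc; _<_)
open import Data.Fin using (Fin)
open import Data.Fin.Subset using (Subset; ⁅_⁆; _∈_; _∉_; _∪_; _-_; ∣_∣; ⊥)
open import Data.Product using (Σ; _×_; _,_)
open import Relation.Binary.PropositionalEquality using (_≡_)

-- A set system on the finite ground set E = Fin n is a predicate on subsets
-- of Fin n:  F A  means  "A ∈ 𝓕".
SetSystem : ℕ → Set₁
SetSystem n = Subset n → Set

record IsGreedoid {n : ℕ} (F : SetSystem n) : Set where
  field
    empty∈     : F ⊥
    accessible : ∀ B → F B → 0 < ∣ B ∣ →
                 Σ (Fin n) λ b → b ∈ B × F (B - b)
    exchange   : ∀ A B → F A → F B → ∣ B ∣ ≡ suc ∣ A ∣ →
                 Σ (Fin n) λ b → b ∈ B × b ∉ A × F (A ∪ ⁅ b ⁆)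

record IsStrongGreedoid {n : ℕ} (F : SetSystem n) : Set where
  field
    isGreedoid     : IsGreedoid F
    strongExchange : ∀ A B → F A → F B → ∣ B ∣ ≡ suc ∣ A ∣ →
                     Σ (Fin n) λ x → x ∈ B × x ∉ A × F (A ∪ ⁅ x ⁆) × F (B - x)

-- * If B₁ ∖ {x} ∈ F, ordinary greedoid exchange of B₁ ∖ {x} against B₂
--   already gives y  (replacement-from-deletion).
-- * Otherwise accessibility gives b ≠ x with B₁ ∖ {b} ∈ F and c with
--   B₂ ∖ {c} ∈ F; induction yields y ∈ B₂ ∖ B₁ ∖ {b} with
--   D = ((B₁ ∖ {b}) ∪ {y}) ∖ {x} ∈ F.  If y = b then D = B₁ ∖ {x}.  Else
--   |B₁| = |D| + 1 and the strong exchange of D against B₁ gives w ∈ B₁ ∖ D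
--   with D ∪ {w} ∈ F and B₁ ∖ {w} ∈ F.  Since B₁ ∖ D ⊆ {x, b}, either w = x
--   (then B₁ ∖ {x} ∈ F) or w = b, and D ∪ {b} = (B₁ ∪ {y}) ∖ {x}
--   (replacement-from-smaller).
module Submission where

open import Defs
open import Data.Nat using (ℕ; zero; suc; _<_; z≤n; s≤s)
open import Data.Nat.Properties using (suc-injective; ≤-trans)
open import Data.Fin using (Fin; zero; suc; _≟_)
open import Data.Fin.Subset using (Subset; ⁅_⁆; _∈_; _∉_; _⊆_; _∪_; _-_; _─_; ∣_∣; inside; outside)
open import Data.Fin.Subset.Properties
  using (x∈⁅x⁆; x∈⁅y⁆⇒x≡y; ⊆-antisym; x∈p∪q⁻; x∈p∪q⁺; ∪-assoc; ∪-comm; p─⊥≡p; p─q⊆p;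
         x∈p∧x≢y⇒x∈p-y; p─x─y≡p─y─x; x∈p⇒∣p-x∣<∣p∣)
open import Data.Product using (Σ; _×_; _,_; proj₁)
open import Data.Sum using (_⊎_; inj₁; inj₂)
import Data.Sum as Sum
open import Data.Vec using (_∷_; here; there)
open import Data.Empty using (⊥-elim)
open import Relation.Binary.PropositionalEquality
open import Relation.Nullary using (yes; no)
open import Function using (_∘_)

private
  variable
    n : ℕ
    i x y : Fin n
    p q : Subset n

∈-─⇒∉ : i ∈ p ─ q → i ∉ q
∈-─⇒∉ {p = _ ∷ p} {inside  ∷ q} (there h) (there h') = ∈-─⇒∉ h h'
∈-─⇒∉ {p = _ ∷ p} {outside ∷ q} (there h) (there h') = ∈-─⇒∉ h h'

∈-remove⁻ : i ∈ p - x → i ∈ p × i ≢ x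
∈-remove⁻ {p = p} {x = x} h = p─q⊆p p ⁅ x ⁆ h , λ { refl → ∈-─⇒∉ h (x∈⁅x⁆ x) }

∈-insert⁻ : i ∈ p ∪ ⁅ y ⁆ → i ∈ p ⊎ i ≡ y
∈-insert⁻ {p = p} {y = y} h = Sum.map₂ (x∈⁅y⁆⇒x≡y y) (x∈p∪q⁻ p ⁅ y ⁆ h)

∈-insertˡ : i ∈ p → i ∈ p ∪ ⁅ y ⁆
∈-insertˡ h = x∈p∪q⁺ (inj₁ h)

∈-insert-self : y ∈ p ∪ ⁅ y ⁆
∈-insert-self {y = y} = x∈p∪q⁺ (inj₂ (x∈⁅x⁆ y))

remove-insert : y ∉ p → (p ∪ ⁅ y ⁆) - y ≡ p
remove-insert {y = y} {p = p} y∉p = ⊆-antisym to from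
  where
  to : (p ∪ ⁅ y ⁆) - y ⊆ p
  to h with ∈-remove⁻ h
  ... | h' , i≢y with ∈-insert⁻ h'
  ... | inj₁ i∈p = i∈p
  ... | inj₂ i≡y = ⊥-elim (i≢y i≡y)
  from : p ⊆ (p ∪ ⁅ y ⁆) - y
  from h = x∈p∧x≢y⇒x∈p-y (∈-insertˡ h) λ { refl → y∉p h }

insert-remove : y ∈ p → (p - y) ∪ ⁅ y ⁆ ≡ p
insert-remove {y = y} {p = p} y∈p = ⊆-antisym to from
  where
  to : (p - y) ∪ ⁅ y ⁆ ⊆ p
  to h with ∈-insert⁻ h
  ... | inj₁ h' = proj₁ (∈-remove⁻ h')
  ... | inj₂ refl = y∈p
  from : p ⊆ (p - y) ∪ ⁅ y ⁆
  from {i} h with i ≟ y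
  ... | yes refl = ∈-insert-self
  ... | no i≢y = ∈-insertˡ (x∈p∧x≢y⇒x∈p-y h i≢y)

insert-remove-comm : y ≢ x → (p - x) ∪ ⁅ y ⁆ ≡ (p ∪ ⁅ y ⁆) - x
insert-remove-comm {y = y} {x = x} {p = p} y≢x = ⊆-antisym to from
  where
  to : (p - x) ∪ ⁅ y ⁆ ⊆ (p ∪ ⁅ y ⁆) - x
  to h with ∈-insert⁻ h
  ... | inj₁ h' = let i∈p , i≢x = ∈-remove⁻ h' in x∈p∧x≢y⇒x∈p-y (∈-insertˡ i∈p) i≢x
  ... | inj₂ refl = x∈p∧x≢y⇒x∈p-y ∈-insert-self y≢x
  from : (p ∪ ⁅ y ⁆) - x ⊆ (p - x) ∪ ⁅ y ⁆
  from h with ∈-remove⁻ h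
  ... | h' , i≢x with ∈-insert⁻ h'
  ... | inj₁ i∈p = ∈-insertˡ (x∈p∧x≢y⇒x∈p-y i∈p i≢x)
  ... | inj₂ refl = ∈-insert-self

insert-insert-comm : (p ∪ ⁅ x ⁆) ∪ ⁅ y ⁆ ≡ (p ∪ ⁅ y ⁆) ∪ ⁅ x ⁆
insert-insert-comm {p = p} {x = x} {y = y} = begin
  (p ∪ ⁅ x ⁆) ∪ ⁅ y ⁆  ≡⟨ ∪-assoc p ⁅ x ⁆ ⁅ y ⁆ ⟩
  p ∪ (⁅ x ⁆ ∪ ⁅ y ⁆)  ≡⟨ cong (p ∪_) (∪-comm ⁅ x ⁆ ⁅ y ⁆) ⟩
  p ∪ (⁅ y ⁆ ∪ ⁅ x ⁆)  ≡⟨ ∪-assoc p ⁅ y ⁆ ⁅ x ⁆ ⟨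
  (p ∪ ⁅ y ⁆) ∪ ⁅ x ⁆  ∎
  where open ≡-Reasoning

card-remove : x ∈ p → ∣ p ∣ ≡ suc ∣ p - x ∣
card-remove {x = zero}  {p = inside ∷ p}  here      = cong (λ q → suc ∣ q ∣) (sym (p─⊥≡p p))
card-remove {x = suc x} {p = inside ∷ p}  (there h) = cong suc (card-remove h)
card-remove {x = suc x} {p = outside ∷ p} (there h) = card-remove h

card-insert : y ∉ p → ∣ p ∪ ⁅ y ⁆ ∣ ≡ suc ∣ p ∣
card-insert {y = y} {p = p} y∉p = begin
  ∣ p ∪ ⁅ y ⁆ ∣              ≡⟨ card-remove (∈-insert-self {p = p}) ⟩
  suc ∣ (p ∪ ⁅ y ⁆) - y ∣    ≡⟨ cong (λ q → suc ∣ q ∣) (remove-insert y∉p) ⟩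
  suc ∣ p ∣                  ∎
  where open ≡-Reasoning

nonempty : x ∈ p → 0 < ∣ p ∣
nonempty x∈p = ≤-trans (s≤s z≤n) (x∈p⇒∣p-x∣<∣p∣ x∈p)

card-remove-both : x ∈ p → y ∈ q → ∣ p ∣ ≡ ∣ q ∣ → ∣ p - x ∣ ≡ ∣ q - y ∣
card-remove-both x∈p y∈q p≈q = suc-injective (trans (sym (card-remove x∈p)) (trans p≈q (card-remove y∈q)))

module _ {B : Subset n} {b x y : Fin n} where

  card-shifted : b ∈ B → x ∈ B - b → y ∉ B - b → ∣ B ∣ ≡ suc ∣ ((B - b) ∪ ⁅ y ⁆) - x ∣
  card-shifted b∈B x∈B-b y∉B-b = begin
    ∣ B ∣                               ≡⟨ card-remove b∈B ⟩
    suc ∣ B - b ∣                       ≡⟨ card-insert y∉B-b ⟨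
    ∣ (B - b) ∪ ⁅ y ⁆ ∣                 ≡⟨ card-remove (∈-insertˡ x∈B-b) ⟩
    suc ∣ ((B - b) ∪ ⁅ y ⁆) - x ∣       ∎
    where open ≡-Reasoning

  missing-from-shifted : ∀ {w} → w ∈ B → w ∉ ((B - b) ∪ ⁅ y ⁆) - x → w ≡ x ⊎ w ≡ b
  missing-from-shifted {w} w∈B w∉D with w ≟ x | w ≟ b
  ... | yes w≡x | _       = inj₁ w≡x
  ... | no _    | yes w≡b = inj₂ w≡b
  ... | no w≢x  | no w≢b  = ⊥-elim (w∉D (x∈p∧x≢y⇒x∈p-y (∈-insertˡ (x∈p∧x≢y⇒x∈p-y w∈B w≢b)) w≢x))

  shifted-insert : b ∈ B → b ≢ x → y ≢ x → (((B - b) ∪ ⁅ y ⁆) - x) ∪ ⁅ b ⁆ ≡ (B ∪ ⁅ y ⁆) - x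
  shifted-insert b∈B b≢x y≢x = begin
    (((B - b) ∪ ⁅ y ⁆) - x) ∪ ⁅ b ⁆   ≡⟨ cong (_∪ ⁅ b ⁆) (insert-remove-comm y≢x) ⟨
    (((B - b) - x) ∪ ⁅ y ⁆) ∪ ⁅ b ⁆   ≡⟨ insert-insert-comm ⟩
    (((B - b) - x) ∪ ⁅ b ⁆) ∪ ⁅ y ⁆   ≡⟨ cong (λ C → (C ∪ ⁅ b ⁆) ∪ ⁅ y ⁆) (p─x─y≡p─y─x B b x) ⟩
    (((B - x) - b) ∪ ⁅ b ⁆) ∪ ⁅ y ⁆   ≡⟨ cong (_∪ ⁅ y ⁆) (insert-remove (x∈p∧x≢y⇒x∈p-y b∈B b≢x)) ⟩
    (B - x) ∪ ⁅ y ⁆                   ≡⟨ insert-remove-comm y≢x ⟩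
    (B ∪ ⁅ y ⁆) - x                   ∎
    where open ≡-Reasoning

Replacement : SetSystem n → Subset n → Subset n → Fin n → Set
Replacement {n} F B₁ B₂ x = Σ (Fin n) λ y → y ∈ B₂ × y ∉ B₁ × F ((B₁ ∪ ⁅ y ⁆) - x)

replacement-from-deletion : {F : SetSystem n} {B₁ B₂ : Subset n} → IsGreedoid F →
                            F (B₁ - x) → F B₂ → ∣ B₁ ∣ ≡ ∣ B₂ ∣ → x ∈ B₁ → x ∉ B₂ →
                            Replacement F B₁ B₂ x
replacement-from-deletion {x = x} {F = F} {B₁} {B₂} G FB₁-x FB₂ B₁≈B₂ x∈B₁ x∉B₂
  with IsGreedoid.exchange G (B₁ - x) B₂ FB₁-x FB₂ (trans (sym B₁≈B₂) (card-remove x∈B₁))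
... | y , y∈B₂ , y∉B₁-x , FB₁-x+y = y , y∈B₂ , y∉B₁ , subst F (insert-remove-comm y≢x) FB₁-x+y
  where
  y≢x : y ≢ x
  y≢x refl = x∉B₂ y∈B₂
  y∉B₁ : y ∉ B₁
  y∉B₁ y∈B₁ = y∉B₁-x (x∈p∧x≢y⇒x∈p-y y∈B₁ y≢x)

module _ {F : SetSystem n} (SG : IsStrongGreedoid F) where
  open IsStrongGreedoid SG
  open IsGreedoid isGreedoid

  replacement-from-smaller : {B₁ B₂ : Subset n} {b : Fin n} →
    F B₁ → F B₂ → ∣ B₁ ∣ ≡ ∣ B₂ ∣ → x ∈ B₁ → x ∉ B₂ → b ∈ B₁ → b ≢ x →
    y ∈ B₂ → y ∉ B₁ - b → F (((B₁ - b) ∪ ⁅ y ⁆) - x) → Replacement F B₁ B₂ x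
  replacement-from-smaller {x = x} {y = y} {B₁} {B₂} {b} FB₁ FB₂ B₁≈B₂ x∈B₁ x∉B₂ b∈B₁ b≢x y∈B₂ y∉B₁-b FD
    with y ≟ b
  ... | yes refl = replacement-from-deletion isGreedoid FB₁-x FB₂ B₁≈B₂ x∈B₁ x∉B₂
    where
    FB₁-x : F (B₁ - x)
    FB₁-x = subst F (cong (_- x) (insert-remove b∈B₁)) FD
  ... | no y≢b
    with strongExchange _ B₁ FD FB₁ (card-shifted b∈B₁ (x∈p∧x≢y⇒x∈p-y x∈B₁ (b≢x ∘ sym)) y∉B₁-b)
  ... | w , w∈B₁ , w∉D , FD+w , FB₁-w with missing-from-shifted w∈B₁ w∉D
  ... | inj₁ refl = replacement-from-deletion isGreedoid FB₁-w FB₂ B₁≈B₂ x∈B₁ x∉B₂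
  ... | inj₂ refl = y , y∈B₂ , y∉B₁ , subst F (shifted-insert b∈B₁ b≢x y≢x) FD+w
    where
    y≢x : y ≢ x
    y≢x refl = x∉B₂ y∈B₂
    y∉B₁ : y ∉ B₁
    y∉B₁ y∈B₁ = y∉B₁-b (x∈p∧x≢y⇒x∈p-y y∈B₁ y≢b)

  replacement : (k : ℕ) {B₁ B₂ : Subset n} {x : Fin n} → ∣ B₁ ∣ ≡ k → F B₁ → F B₂ → ∣ B₁ ∣ ≡ ∣ B₂ ∣ →
                x ∈ B₁ → x ∉ B₂ → Replacement F B₁ B₂ x
  replacement zero    |B₁|≡0 _ _ _ x∈B₁ _ with () ← trans (sym (card-remove x∈B₁)) |B₁|≡0
  replacement (suc k) {B₁} {B₂} {x} |B₁|≡1+k FB₁ FB₂ B₁≈B₂ x∈B₁ x∉B₂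
    with accessible B₁ FB₁ (nonempty x∈B₁)
       | accessible B₂ FB₂ (subst (0 <_) B₁≈B₂ (nonempty x∈B₁))
  ... | b , b∈B₁ , FB₁-b | c , c∈B₂ , FB₂-c with b ≟ x
  ... | yes refl = replacement-from-deletion isGreedoid FB₁-b FB₂ B₁≈B₂ x∈B₁ x∉B₂
  ... | no b≢x
    with replacement k (suc-injective (trans (sym (card-remove b∈B₁)) |B₁|≡1+k)) FB₁-b FB₂-c
                     (card-remove-both b∈B₁ c∈B₂ B₁≈B₂)
                     (x∈p∧x≢y⇒x∈p-y x∈B₁ (b≢x ∘ sym)) (x∉B₂ ∘ proj₁ ∘ ∈-remove⁻)
  ... | y , y∈B₂-c , y∉B₁-b , FD =
    replacement-from-smaller FB₁ FB₂ B₁≈B₂ x∈B₁ x∉B₂ b∈B₁ b≢x (proj₁ (∈-remove⁻ y∈B₂-c)) y∉B₁-b FD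

theorem7p2 : (n : ℕ) (F : SetSystem n) → IsStrongGreedoid F →
             (B₁ B₂ : Subset n) → F B₁ → F B₂ → ∣ B₁ ∣ ≡ ∣ B₂ ∣ →
             (x : Fin n) → x ∈ B₁ → x ∉ B₂ →
             Σ (Fin n) λ y → y ∈ B₂ × y ∉ B₁ × F ((B₁ ∪ ⁅ y ⁆) - x)
theorem7p2 n F SG B₁ B₂ FB₁ FB₂ B₁≈B₂ x x∈B₁ x∉B₂ =
  replacement SG ∣ B₁ ∣ refl FB₁ FB₂ B₁≈B₂ x∈B₁ x∉B₂
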